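{- For each integer $n>1$, there is a connected $(3n-2)$-regular integral graph with $6n$ vertices.
   Context: A graph is integral if all eigenvalues of its adjacency matrix are integers. -}

module Defs where

open import Data.Nat using (ℕ; zero; suc)
open import Data.Bool using (Bool; true; false; if_then_else_)
open import Data.Fin using (Fin; zero; suc; punchIn)
open import Data.Fin.Properties using () renaming (_≟_ to _≟ᶠ_)
open import Data.Integer using (ℤ; _+_; _*_; _-_; -_; +_)
open import Data.Vec using (Vec; lookup)
open import Data.Product using (Σ; _×_; ∃-syntax)
open import Relation.Nullary using (does)
open import Relation.Binary.PropositionalEquality using (_≡_)

record Graph (m : ℕ) : Set where
  field
    adj    : Fin m → Fin m → Bool
    sym    : ∀ i j → adj i j ≡ adj j i
    irrefl : ∀ i → adj i i ≡ false
open Graph public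

sumℕ : ∀ {n} → (Fin n → ℕ) → ℕ
sumℕ {zero}  f = 0
sumℕ {suc n} f = f zero Data.Nat.+ sumℕ (λ i → f (suc i))

sumℤ : ∀ {n} → (Fin n → ℤ) → ℤ
sumℤ {zero}  f = + 0
sumℤ {suc n} f = f zero + sumℤ (λ i → f (suc i))

degree : ∀ {m} → Graph m → Fin m → ℕ
degree G v = sumℕ (λ w → if adj G v w then 1 else 0)

Regular : ∀ {m} → Graph m → ℕ → Set
Regular G k = ∀ v → degree G v ≡ k

data Walk {m} (G : Graph m) : Fin m → Fin m → Set where
  here : ∀ {u} → Walk G u u
  step : ∀ {u w v} → adj G u w ≡ true → Walk G w v → Walk G u v

Connected : ∀ {m} → Graph m → Set
Connected G = ∀ u v → Walk G u v

Matrix : ℕ → Set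
Matrix n = Fin n → Fin n → ℤ

sgn : ℕ → ℤ
sgn zero = + 1
sgn (suc j) = - sgn j

det : ∀ {n} → Matrix n → ℤ
det {zero}  M = + 1
det {suc n} M = sumℤ (λ j → sgn (Data.Fin.toℕ j) * M zero j * det (λ i k → M (suc i) (punchIn j k)))

adjMatrix : ∀ {m} → Graph m → Matrix m
adjMatrix G i j = if adj G i j then + 1 else + 0

identity : ∀ {n} → Matrix n
identity i j = if does (i ≟ᶠ j) then + 1 else + 0

-- characteristic polynomial det(xI - A), as a polynomial function on ℤ
charPoly : ∀ {n} → Matrix n → ℤ → ℤ
charPoly A x = det (λ i j → x * identity i j - A i j)

prodℤ : ∀ {n} → (Fin n → ℤ) → ℤ
prodℤ {zero}  f = + 1
prodℤ {suc n} f = f zero * prodℤ (λ i → f (suc i))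

-- integral graph: all eigenvalues (with multiplicity) of the adjacency matrix
-- are integers, i.e. det(xI - A) = ∏ (x - λᵢ) with λᵢ ∈ ℤ
Integral : ∀ {m} → Graph m → Set
Integral {m} G = Σ (Vec ℤ m) λ ev →
  ∀ x → charPoly (adjMatrix G) x ≡ prodℤ (λ i → x - lookup ev i)

-- Take n ≥ 2 layers, each a copy of the prism K₃ □ K₂ (two triangles joined by three rungs). Inside a
-- layer keep only the rungs; join vertices of different layers whenever their positions are adjacent
-- in the prism. Every vertex then has 1 + 3(n − 1) = 3n − 2 neighbours, and the graph is connected.
--
-- With P the prism, B the rungs and C = P − B the two triangles, the adjacency matrix is
-- J_n ⊗ P − I_n ⊗ C, so xI − A = I_n ⊗ Y − J_n ⊗ W with Y = xI + C and W = P. Subtracting block row 1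
-- from block row 0 and adding block column 0 to block column 1 splits off a block Y, and induction
-- gives det(xI − A) = det(Y)^(n−1) · det(Y − nW). Over the triangle, Y − sW is again of the form
-- I₃ ⊗ A − J₃ ⊗ B with 2 × 2 blocks, so the same formula factors it completely:
-- det(Y − sW) = (x − 1)² (x + 2s − 1)² (x − s + 2) (x − 3s + 2), with s = 0 and s = n.

module Submission where

module LayeredPrism where

  open import Defs hiding (sym)
  open import Data.Bool using (Bool; true; false; if_then_else_; _∧_; not; _xor_)
  import Data.Bool
  open import Data.Fin as Fin
    using (Fin; zero; suc; toℕ; punchIn; punchOut; _↑ˡ_; _↑ʳ_; combine; remQuot; quotient; remainder)
  open import Data.Fin.Properties
    using ( all?; punchIn-punchOut; punchInᵢ≢i; punchIn-injective; toℕ-inject₁; toℕ-injective; toℕ<n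
          ; toℕ-fromℕ<; toℕ-↑ˡ; splitAt-↑ʳ; remQuot-combine; combine-remQuot)
  open import Data.Integer using (ℤ; +_; -_; _+_; _*_; _-_; _^_)
  open import Data.Integer.Properties
    using ( +-comm; +-assoc; +-identityˡ; +-identityʳ; *-comm; *-assoc; *-identityˡ; *-identityʳ; *-zeroʳ
          ; neg-involutive; +-*-semiring)
  open import Algebra.Properties.Semiring.Sum +-*-semiring
    using (sum; sum-cong-≗; ∑-distrib-+; ∑-comm; *-distribˡ-sum; *-distribʳ-sum; sum-remove)
  open import Data.Integer.Tactic.RingSolver using (solve-∀)
  open import Data.Nat as ℕ using (ℕ; zero; suc)
  import Data.Nat.Properties as ℕ
  open import Data.Product using (_×_; _,_; proj₁; proj₂)
  open import Data.Sum using (_⊎_; inj₁; inj₂; [_,_])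
  open import Data.Vec using (_∷_; []; lookup; tabulate)
  open import Data.Vec.Properties using (lookup∘tabulate)
  open import Function using (_∘_; flip)
  open import Relation.Binary using (tri<; tri≈; tri>)
  open import Relation.Binary.PropositionalEquality
    using (_≡_; _≢_; refl; sym; trans; cong; cong₂; subst; module ≡-Reasoning)
  open import Relation.Nullary using (yes; no; does; contradiction)
  open import Relation.Nullary.Decidable using (dec-true; dec-false; from-yes)

  -- Finite sums and products

  sumℤ≡sum : ∀ {n} (f : Fin n → ℤ) → sumℤ f ≡ sum f
  sumℤ≡sum {zero}  f = refl
  sumℤ≡sum {suc n} f = cong (_+_ (f zero)) (sumℤ≡sum (f ∘ suc))

  sumℤ-cong : ∀ {n} {f g : Fin n → ℤ} → (∀ i → f i ≡ g i) → sumℤ f ≡ sumℤ g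
  sumℤ-cong {zero}  f≗g = refl
  sumℤ-cong {suc n} f≗g = cong₂ _+_ (f≗g zero) (sumℤ-cong (f≗g ∘ suc))

  sumℤ-zero : ∀ {n} {f : Fin n → ℤ} → (∀ i → f i ≡ + 0) → sumℤ f ≡ + 0
  sumℤ-zero {zero}  f≗0 = refl
  sumℤ-zero {suc n} f≗0 = cong₂ _+_ (f≗0 zero) (sumℤ-zero (f≗0 ∘ suc))

  sumℤ-ones : ∀ n → sumℤ {n} (λ _ → + 1) ≡ + n
  sumℤ-ones zero    = refl
  sumℤ-ones (suc n) = cong (_+_ (+ 1)) (sumℤ-ones n)

  sumℤ-distrib-+ : ∀ {n} (f g : Fin n → ℤ) → sumℤ (λ i → f i + g i) ≡ sumℤ f + sumℤ g
  sumℤ-distrib-+ f g =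
    trans (sumℤ≡sum (λ i → f i + g i)) (trans (∑-distrib-+ f g) (sym (cong₂ _+_ (sumℤ≡sum f) (sumℤ≡sum g))))

  *-distribˡ-sumℤ : ∀ {n} x (f : Fin n → ℤ) → x * sumℤ f ≡ sumℤ (λ i → x * f i)
  *-distribˡ-sumℤ x f =
    trans (cong (x *_) (sumℤ≡sum f)) (trans (*-distribˡ-sum x f) (sym (sumℤ≡sum (λ i → x * f i))))

  *-distribʳ-sumℤ : ∀ {n} x (f : Fin n → ℤ) → sumℤ f * x ≡ sumℤ (λ i → f i * x)
  *-distribʳ-sumℤ x f =
    trans (cong (_* x) (sumℤ≡sum f)) (trans (*-distribʳ-sum x f) (sym (sumℤ≡sum (λ i → f i * x))))

  sumℤ-linear : ∀ {n} (s t : ℤ) (f g : Fin n → ℤ) →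
    sumℤ (λ i → s * f i + t * g i) ≡ s * sumℤ f + t * sumℤ g
  sumℤ-linear s t f g = trans (sumℤ-distrib-+ (λ i → s * f i) (λ i → t * g i))
    (sym (cong₂ _+_ (*-distribˡ-sumℤ s f) (*-distribˡ-sumℤ t g)))

  sumℤ-comm : ∀ {m n} (f : Fin m → Fin n → ℤ) →
    sumℤ (λ i → sumℤ (f i)) ≡ sumℤ (λ j → sumℤ (λ i → f i j))
  sumℤ-comm f = trans (asSum f) (trans (∑-comm f) (sym (asSum (flip f))))
    where
    asSum : ∀ {m n} (g : Fin m → Fin n → ℤ) → sumℤ (λ i → sumℤ (g i)) ≡ sum (λ i → sum (g i))
    asSum g = trans (sumℤ≡sum (λ i → sumℤ (g i))) (sum-cong-≗ (λ i → sumℤ≡sum (g i)))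

  sumℤ-remove : ∀ {n} (f : Fin (suc n) → ℤ) i → sumℤ f ≡ f i + sumℤ (f ∘ punchIn i)
  sumℤ-remove f i =
    trans (sumℤ≡sum f) (trans (sum-remove f) (cong (_+_ (f i)) (sym (sumℤ≡sum (f ∘ punchIn i)))))

  sumℤ-twoPoints : ∀ {n} (f : Fin n → ℤ) {a b : Fin n} → a ≢ b →
    (∀ j → j ≢ a → j ≢ b → f j ≡ + 0) → sumℤ f ≡ f a + f b
  sumℤ-twoPoints {suc zero}    f {zero} {zero} a≢b _ = contradiction refl a≢b
  sumℤ-twoPoints {suc (suc n)} f {a} {b} a≢b others = begin
    sumℤ f
      ≡⟨ sumℤ-remove f a ⟩
    f a + sumℤ (f ∘ punchIn a)
      ≡⟨ cong (_+_ (f a)) (sumℤ-remove (f ∘ punchIn a) b′) ⟩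
    f a + (f (punchIn a b′) + sumℤ (f ∘ punchIn a ∘ punchIn b′))
      ≡⟨ cong₂ (λ x y → f a + (f x + y)) (punchIn-punchOut a≢b) (sumℤ-zero rest) ⟩
    f a + (f b + + 0)
      ≡⟨ cong (_+_ (f a)) (+-identityʳ (f b)) ⟩
    f a + f b
      ∎
    where
    open ≡-Reasoning
    b′ = punchOut a≢b
    rest : ∀ l → f (punchIn a (punchIn b′ l)) ≡ + 0
    rest l = others _ (punchInᵢ≢i a _) λ eq →
      punchInᵢ≢i b′ l (punchIn-injective a _ _ (trans eq (sym (punchIn-punchOut a≢b))))

  sumℤ-↑ : ∀ k {m} (f : Fin (k ℕ.+ m) → ℤ) → sumℤ f ≡ sumℤ (f ∘ (_↑ˡ m)) + sumℤ (f ∘ (k ↑ʳ_))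
  sumℤ-↑ zero    f = sym (+-identityˡ _)
  sumℤ-↑ (suc k) f = trans (cong (_+_ (f zero)) (sumℤ-↑ k (f ∘ suc))) (sym (+-assoc (f zero) _ _))

  prodℤ-cong : ∀ {n} {f g : Fin n → ℤ} → (∀ i → f i ≡ g i) → prodℤ f ≡ prodℤ g
  prodℤ-cong {zero}  f≗g = refl
  prodℤ-cong {suc n} f≗g = cong₂ _*_ (f≗g zero) (prodℤ-cong (f≗g ∘ suc))

  prodℤ-↑ : ∀ k {m} (f : Fin (k ℕ.+ m) → ℤ) → prodℤ f ≡ prodℤ (f ∘ (_↑ˡ m)) * prodℤ (f ∘ (k ↑ʳ_))
  prodℤ-↑ zero    f = sym (*-identityˡ _)
  prodℤ-↑ (suc k) f = trans (cong (f zero *_) (prodℤ-↑ k (f ∘ suc))) (sym (*-assoc (f zero) _ _))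

  prodℤ-blocks : ∀ N {b} (f : Fin (N ℕ.* b) → ℤ) →
    prodℤ f ≡ prodℤ (λ J → prodℤ (λ q → f (combine {N} {b} J q)))
  prodℤ-blocks zero    f = refl
  prodℤ-blocks (suc N) {b} f =
    trans (prodℤ-↑ b f) (cong (prodℤ (f ∘ (_↑ˡ N ℕ.* b)) *_) (prodℤ-blocks N (f ∘ (b ↑ʳ_))))

  prodℤ-const : ∀ n (x : ℤ) → prodℤ {n} (λ _ → x) ≡ x ^ n
  prodℤ-const zero    x = refl
  prodℤ-const (suc n) x = cong (x *_) (prodℤ-const n x)

  sumℕ-cong : ∀ {n} {f g : Fin n → ℕ} → (∀ i → f i ≡ g i) → sumℕ f ≡ sumℕ g
  sumℕ-cong {zero}  f≗g = refl
  sumℕ-cong {suc n} f≗g = cong₂ ℕ._+_ (f≗g zero) (sumℕ-cong (f≗g ∘ suc))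

  sumℕ-↑ : ∀ k {m} (f : Fin (k ℕ.+ m) → ℕ) → sumℕ f ≡ sumℕ (f ∘ (_↑ˡ m)) ℕ.+ sumℕ (f ∘ (k ↑ʳ_))
  sumℕ-↑ zero    f = refl
  sumℕ-↑ (suc k) f = trans (cong (f zero ℕ.+_) (sumℕ-↑ k (f ∘ suc))) (sym (ℕ.+-assoc (f zero) _ _))

  sumℕ-blocks : ∀ N {b} (f : Fin (N ℕ.* b) → ℕ) →
    sumℕ f ≡ sumℕ (λ J → sumℕ (λ q → f (combine {N} {b} J q)))
  sumℕ-blocks zero    f = refl
  sumℕ-blocks (suc N) {b} f =
    trans (sumℕ-↑ b f) (cong (sumℕ (f ∘ (_↑ˡ N ℕ.* b)) ℕ.+_) (sumℕ-blocks N (f ∘ (b ↑ʳ_))))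

  sumℕ-const : ∀ n (x : ℕ) → sumℕ {n} (λ _ → x) ≡ n ℕ.* x
  sumℕ-const zero    x = refl
  sumℕ-const (suc n) x = cong (x ℕ.+_) (sumℕ-const n x)

  sumℕ-≟ : ∀ {N} (I : Fin (suc N)) (a b : ℕ) →
    sumℕ (λ J → if does (I Fin.≟ J) then a else b) ≡ a ℕ.+ N ℕ.* b
  sumℕ-≟ {N}     zero    a b = cong (a ℕ.+_) (sumℕ-const N b)
  sumℕ-≟ {suc N} (suc I) a b = trans (cong (b ℕ.+_) (sumℕ-≟ I a b))
    (trans (sym (ℕ.+-assoc b a _)) (trans (cong (ℕ._+ N ℕ.* b) (ℕ.+-comm b a)) (ℕ.+-assoc a b _)))

  -- Determinants

  minor : ∀ {n} → Fin (suc n) → Matrix (suc n) → Matrix n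
  minor j M i k = M (suc i) (punchIn j k)

  laplaceTerm : ∀ {n} → Matrix (suc n) → Fin (suc n) → ℤ
  laplaceTerm M j = sgn (toℕ j) * M zero j * det (minor j M)

  _ᵀ : ∀ {n} → Matrix n → Matrix n
  (M ᵀ) i j = M j i

  det-cong : ∀ {n} {M N : Matrix n} → (∀ i j → M i j ≡ N i j) → det M ≡ det N
  det-cong {zero}  M≗N = refl
  det-cong {suc n} M≗N = sumℤ-cong λ j →
    cong₂ (λ a d → sgn (toℕ j) * a * d) (M≗N zero j) (det-cong λ i k → M≗N (suc i) (punchIn j k))

  det-expandColumn : ∀ {n} (M : Matrix (suc n)) →
    det M ≡ sumℤ (λ i → sgn (toℕ i) * M i zero * det (λ a b → M (punchIn i a) (suc b)))
  det-expandColumn {zero}  M = refl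
  det-expandColumn {suc n} M = cong (_+_ (laplaceTerm M zero)) (begin
    sumℤ (λ j → σ (suc j) * row j * det (minor (suc j) M))
      ≡⟨ sumℤ-cong (λ j → cong (σ (suc j) * row j *_) (det-expandColumn (minor (suc j) M))) ⟩
    sumℤ (λ j → σ (suc j) * row j * sumℤ (λ i → σ i * col i * D i j))
      ≡⟨ sumℤ-cong (λ j → *-distribˡ-sumℤ (σ (suc j) * row j) (λ i → σ i * col i * D i j)) ⟩
    sumℤ (λ j → sumℤ (λ i → σ (suc j) * row j * (σ i * col i * D i j)))
      ≡⟨ sumℤ-cong (λ j → sumℤ-cong (λ i → exchange (σ j) (row j) (σ i) (col i) (D i j))) ⟩
    sumℤ (λ j → sumℤ (λ i → σ (suc i) * col i * (σ j * row j * D i j)))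
      ≡⟨ sumℤ-comm (λ j i → σ (suc i) * col i * (σ j * row j * D i j)) ⟩
    sumℤ (λ i → sumℤ (λ j → σ (suc i) * col i * (σ j * row j * D i j)))
      ≡⟨ sumℤ-cong (λ i → sym (*-distribˡ-sumℤ (σ (suc i) * col i) (λ j → σ j * row j * D i j))) ⟩
    sumℤ (λ i → σ (suc i) * col i * det (λ a b → M (punchIn (suc i) a) (suc b)))
      ∎)
    where
    open ≡-Reasoning
    σ : ∀ {m} → Fin m → ℤ
    σ k = sgn (toℕ k)
    row col : Fin (suc n) → ℤ
    row j = M zero (suc j)
    col i = M (suc i) zero
    D : Fin (suc n) → Fin (suc n) → ℤ
    D i j = det (λ a b → M (suc (punchIn i a)) (suc (punchIn j b)))
    exchange : ∀ σj a σi b d → - σj * a * (σi * b * d) ≡ - σi * b * (σj * a * d)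
    exchange = solve-∀

  det-transpose : ∀ {n} (M : Matrix n) → det (M ᵀ) ≡ det M
  det-transpose {zero}  M = refl
  det-transpose {suc n} M = trans
    (sumℤ-cong λ j → cong (sgn (toℕ j) * M j zero *_) (det-transpose (λ a b → M (punchIn j a) (suc b))))
    (sym (det-expandColumn M))

  det-linearInColumn : ∀ {n} (c : Fin n) (s t : ℤ) {L M N : Matrix n} →
    (∀ i j → j ≢ c → L i j ≡ M i j) → (∀ i j → j ≢ c → L i j ≡ N i j) →
    (∀ i → L i c ≡ s * M i c + t * N i c) → det L ≡ s * det M + t * det N
  det-linearInColumn {suc n} c s t {L} {M} {N} L≗M L≗N Lc =
    trans (sumℤ-cong term) (sumℤ-linear s t (laplaceTerm M) (laplaceTerm N))
    where
    term : ∀ j → laplaceTerm L j ≡ s * laplaceTerm M j + t * laplaceTerm N j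
    term j with j Fin.≟ c
    ... | yes refl = trans (cong₂ (λ x d → sgn (toℕ j) * x * d) (Lc zero) minorM)
            (trans (distrib (sgn (toℕ j)) s t (M zero j) (N zero j) (det (minor j M)))
              (cong (λ d → s * laplaceTerm M j + t * (sgn (toℕ j) * N zero j * d)) minorN))
      where
      minorM : det (minor j L) ≡ det (minor j M)
      minorM = det-cong λ a k → L≗M (suc a) (punchIn j k) (punchInᵢ≢i j k)
      minorN : det (minor j M) ≡ det (minor j N)
      minorN = trans (sym minorM) (det-cong λ a k → L≗N (suc a) (punchIn j k) (punchInᵢ≢i j k))
      distrib : ∀ σ s t x y d → σ * (s * x + t * y) * d ≡ s * (σ * x * d) + t * (σ * y * d)
      distrib = solve-∀
    ... | no j≢c = trans (cong (sgn (toℕ j) * L zero j *_) minorLinear)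
            (trans (distrib (sgn (toℕ j)) s t (L zero j) (det (minor j M)) (det (minor j N)))
              (cong₂ (λ x y → s * (sgn (toℕ j) * x * det (minor j M)) + t * (sgn (toℕ j) * y * det (minor j N)))
                (L≗M zero j j≢c) (L≗N zero j j≢c)))
      where
      c′ = punchOut j≢c
      avoids : ∀ k → k ≢ c′ → punchIn j k ≢ c
      avoids k k≢c′ eq = k≢c′ (punchIn-injective j k c′ (trans eq (sym (punchIn-punchOut j≢c))))
      minorLinear : det (minor j L) ≡ s * det (minor j M) + t * det (minor j N)
      minorLinear = det-linearInColumn c′ s t
        (λ a k k≢c′ → L≗M (suc a) (punchIn j k) (avoids k k≢c′))
        (λ a k k≢c′ → L≗N (suc a) (punchIn j k) (avoids k k≢c′))
        (λ a → subst (λ x → L (suc a) x ≡ s * M (suc a) x + t * N (suc a) x)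
                 (sym (punchIn-punchOut j≢c)) (Lc (suc a)))
      distrib : ∀ σ s t x d e → σ * x * (s * d + t * e) ≡ s * (σ * x * d) + t * (σ * x * e)
      distrib = solve-∀

  adjacent⇒≢ : ∀ {n} {a b : Fin n} → toℕ b ≡ suc (toℕ a) → a ≢ b
  adjacent⇒≢ eq refl = ℕ.1+n≢n (sym eq)

  punchOut-adjacent : ∀ {n} {j a b : Fin (suc n)} (j≢a : j ≢ a) (j≢b : j ≢ b) →
    toℕ b ≡ suc (toℕ a) → toℕ (punchOut j≢b) ≡ suc (toℕ (punchOut j≢a))
  punchOut-adjacent {j = zero} {zero} j≢a j≢b eq = contradiction refl j≢a
  punchOut-adjacent {j = zero} {suc a} {suc b} j≢a j≢b eq = ℕ.suc-injective eq
  punchOut-adjacent {suc n} {suc zero} {zero} {suc zero} j≢a j≢b eq = contradiction refl j≢b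
  punchOut-adjacent {suc (suc n)} {suc (suc j)} {zero} {suc zero} j≢a j≢b eq = refl
  punchOut-adjacent {suc n} {suc j} {suc a} {suc b} j≢a j≢b eq =
    cong suc (punchOut-adjacent (j≢a ∘ cong suc) (j≢b ∘ cong suc) (ℕ.suc-injective eq))

  punchIn-adjacent : ∀ {n} {a b : Fin (suc n)} → toℕ b ≡ suc (toℕ a) → ∀ k →
    punchIn a k ≡ punchIn b k ⊎ (punchIn a k ≡ b × punchIn b k ≡ a)
  punchIn-adjacent {a = zero} {suc zero} eq zero = inj₂ (refl , refl)
  punchIn-adjacent {a = zero} {suc zero} eq (suc k) = inj₁ refl
  punchIn-adjacent {suc n} {suc a} {suc b} eq zero = inj₁ refl
  punchIn-adjacent {suc n} {suc a} {suc b} eq (suc k) with punchIn-adjacent {a = a} {b} (ℕ.suc-injective eq) k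
  ... | inj₁ same = inj₁ (cong suc same)
  ... | inj₂ (p , q) = inj₂ (cong suc p , cong suc q)

  -- Away from a and b every minor again has two equal adjacent columns; the two remaining
  -- Laplace terms have equal minors and opposite signs.
  det-adjacentEqualColumns : ∀ {n} (M : Matrix n) {a b : Fin n} → toℕ b ≡ suc (toℕ a) →
    (∀ i → M i a ≡ M i b) → det M ≡ + 0
  det-adjacentEqualColumns {suc n} M {a} {b} adj colsEq =
    trans (sumℤ-twoPoints (laplaceTerm M) (adjacent⇒≢ adj) vanishes) cancel
    where
    vanishes : ∀ j → j ≢ a → j ≢ b → laplaceTerm M j ≡ + 0
    vanishes j j≢a j≢b = trans
      (cong (sgn (toℕ j) * M zero j *_)
        (det-adjacentEqualColumns (minor j M) (punchOut-adjacent j≢a j≢b adj) λ i →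
          trans (cong (M (suc i)) (punchIn-punchOut j≢a))
            (trans (colsEq (suc i)) (sym (cong (M (suc i)) (punchIn-punchOut j≢b))))))
      (*-zeroʳ (sgn (toℕ j) * M zero j))
    sameMinor : ∀ i k → M (suc i) (punchIn b k) ≡ M (suc i) (punchIn a k)
    sameMinor i k with punchIn-adjacent adj k
    ... | inj₁ same = cong (M (suc i)) (sym same)
    ... | inj₂ (ka≡b , kb≡a) =
      trans (cong (M (suc i)) kb≡a) (trans (colsEq (suc i)) (cong (M (suc i)) (sym ka≡b)))
    cancel : laplaceTerm M a + laplaceTerm M b ≡ + 0
    cancel rewrite adj | colsEq zero | det-cong sameMinor =
      opposite (sgn (toℕ a)) (M zero b) (det (minor a M))
      where
      opposite : ∀ σ x d → σ * x * d + - σ * x * d ≡ + 0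
      opposite = solve-∀

  withColumn : ∀ {n} → Matrix n → Fin n → (Fin n → ℤ) → Matrix n
  withColumn M c u i j = if does (j Fin.≟ c) then u i else M i j

  withColumn-same : ∀ {n} (M : Matrix n) c u i → withColumn M c u i c ≡ u i
  withColumn-same M c u i rewrite dec-true (c Fin.≟ c) refl = refl

  withColumn-other : ∀ {n} (M : Matrix n) {c j} u i → j ≢ c → withColumn M c u i j ≡ M i j
  withColumn-other M {c} {j} u i j≢c rewrite dec-false (j Fin.≟ c) j≢c = refl

  withColumn-comm : ∀ {n} (M : Matrix n) {a b} u v → a ≢ b →
    ∀ i j → withColumn (withColumn M b v) a u i j ≡ withColumn (withColumn M a u) b v i j
  withColumn-comm M {a} {b} u v a≢b i j with j Fin.≟ a | j Fin.≟ b
  ... | yes refl | yes refl = contradiction refl a≢b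
  ... | yes _    | no _     = refl
  ... | no _     | yes _    = refl
  ... | no _     | no _     = refl

  det-withColumn-linear : ∀ {n} (M : Matrix n) c (s t : ℤ) u v →
    det (withColumn M c (λ i → s * u i + t * v i)) ≡ s * det (withColumn M c u) + t * det (withColumn M c v)
  det-withColumn-linear M c s t u v = det-linearInColumn c s t
    (λ i j j≢c → trans (withColumn-other M w i j≢c) (sym (withColumn-other M u i j≢c)))
    (λ i j j≢c → trans (withColumn-other M w i j≢c) (sym (withColumn-other M v i j≢c)))
    (λ i → trans (withColumn-same M c w i)
             (sym (cong₂ (λ x y → s * x + t * y) (withColumn-same M c u i) (withColumn-same M c v i))))
    where
    w : Fin _ → ℤ
    w i = s * u i + t * v i

  det-withColumn-linearInner : ∀ {n} (M : Matrix n) {a b} → a ≢ b → ∀ x (s t : ℤ) y z →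
    det (withColumn (withColumn M b (λ i → s * y i + t * z i)) a x) ≡
    s * det (withColumn (withColumn M b y) a x) + t * det (withColumn (withColumn M b z) a x)
  det-withColumn-linearInner M {a} {b} a≢b x s t y z =
    trans (det-cong (withColumn-comm M x (λ i → s * y i + t * z i) a≢b))
      (trans (det-withColumn-linear (withColumn M a x) b s t y z)
        (cong₂ (λ p q → s * p + t * q)
          (det-cong λ i j → sym (withColumn-comm M x y a≢b i j))
          (det-cong λ i j → sym (withColumn-comm M x z a≢b i j))))

  -- Expand det with the sum u + v in both columns a and b; the two degenerate terms vanish.
  det-swapAdjacentColumns : ∀ {n} (M : Matrix n) {a b : Fin n} → toℕ b ≡ suc (toℕ a) →
    det (withColumn (withColumn M b (λ i → M i a)) a (λ i → M i b)) ≡ - det M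
  det-swapAdjacentColumns M {a} {b} adj = isolate (degenerate u) (degenerate v)
    (trans (cong (λ d → + 1 * (+ 1 * det (X u u) + + 1 * d) + + 1 * (+ 1 * det (X v u) + + 1 * det (X v v)))
                 (sym original))
           expanded)
    where
    a≢b = adjacent⇒≢ adj
    X : (Fin _ → ℤ) → (Fin _ → ℤ) → Matrix _
    X x y = withColumn (withColumn M b y) a x
    u v w : Fin _ → ℤ
    u i = M i a
    v i = M i b
    w i = + 1 * u i + + 1 * v i
    degenerate : ∀ x → det (X x x) ≡ + 0
    degenerate x = det-adjacentEqualColumns (X x x) adj λ i →
      trans (withColumn-same (withColumn M b x) a x i)
        (sym (trans (withColumn-other (withColumn M b x) x i (a≢b ∘ sym)) (withColumn-same M b x i)))
    original : det (X u v) ≡ det M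
    original = det-cong entry
      where
      entry : ∀ i j → X u v i j ≡ M i j
      entry i j with j Fin.≟ a | j Fin.≟ b
      ... | yes refl | _        = refl
      ... | no _     | yes refl = refl
      ... | no _     | no _     = refl
    expanded : + 1 * (+ 1 * det (X u u) + + 1 * det (X u v)) + + 1 * (+ 1 * det (X v u) + + 1 * det (X v v)) ≡ + 0
    expanded = trans (cong₂ (λ p q → + 1 * p + + 1 * q) (sym (det-withColumn-linearInner M a≢b u (+ 1) (+ 1) u v))
                                                     (sym (det-withColumn-linearInner M a≢b v (+ 1) (+ 1) u v)))
      (trans (sym (det-withColumn-linear (withColumn M b w) a (+ 1) (+ 1) u v)) (degenerate w))
    isolate : ∀ {p q z} → p ≡ + 0 → q ≡ + 0 →
      + 1 * (+ 1 * p + + 1 * det M) + + 1 * (+ 1 * z + + 1 * q) ≡ + 0 → z ≡ - det M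
    isolate {z = z} refl refl eq = trans (sym (cancel (det M) z)) (trans (cong (_+ - det M) eq) (+-identityˡ (- det M)))
      where
      cancel : ∀ m z → + 1 * (+ 1 * + 0 + + 1 * m) + + 1 * (+ 1 * z + + 1 * + 0) + - m ≡ z
      cancel = solve-∀

  -- Swapping column b with its left neighbour k brings the two equal columns one step closer.
  det-equalColumnsAtDistance : ∀ d {n} (M : Matrix n) {a b : Fin n} → toℕ b ≡ suc (d ℕ.+ toℕ a) →
    (∀ i → M i a ≡ M i b) → det M ≡ + 0
  det-equalColumnsAtDistance zero    M dist colsEq = det-adjacentEqualColumns M dist colsEq
  det-equalColumnsAtDistance (suc d) M {a} {suc b} dist colsEq =
    trans (sym (neg-involutive (det M))) (cong -_ (trans (sym (det-swapAdjacentColumns M nextTo)) swappedZero))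
    where
    k = Fin.inject₁ b
    nextTo : toℕ (suc b) ≡ suc (toℕ k)
    nextTo = cong suc (sym (toℕ-inject₁ b))
    distK : toℕ k ≡ suc (d ℕ.+ toℕ a)
    distK = trans (toℕ-inject₁ b) (ℕ.suc-injective dist)
    a≢k : a ≢ k
    a≢k refl = ℕ.m≢1+n+m (toℕ a) distK
    a≢b : a ≢ suc b
    a≢b refl = ℕ.m≢1+n+m (toℕ a) {suc d} dist
    halfSwapped : Matrix _
    halfSwapped = withColumn M (suc b) (λ i → M i k)
    swappedZero : det (withColumn halfSwapped k (λ i → M i (suc b))) ≡ + 0
    swappedZero = det-equalColumnsAtDistance d (withColumn halfSwapped k (λ i → M i (suc b))) distK λ i →
      trans (withColumn-other halfSwapped (λ i → M i (suc b)) i a≢k)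
        (trans (withColumn-other M (λ i → M i k) i a≢b)
          (trans (colsEq i) (sym (withColumn-same halfSwapped k (λ i → M i (suc b)) i))))

  det-equalColumns : ∀ {n} (M : Matrix n) {a b : Fin n} → a ≢ b → (∀ i → M i a ≡ M i b) → det M ≡ + 0
  det-equalColumns M {a} {b} a≢b colsEq with ℕ.<-cmp (toℕ a) (toℕ b)
  ... | tri≈ _ eq _ = contradiction (toℕ-injective eq) a≢b
  ... | tri< a<b _ _ = let (d , eq) = ℕ.m≤n⇒∃[o]m+o≡n a<b in
    det-equalColumnsAtDistance d M (sym (trans (cong suc (ℕ.+-comm d (toℕ a))) eq)) colsEq
  ... | tri> _ _ b<a = let (d , eq) = ℕ.m≤n⇒∃[o]m+o≡n b<a in
    det-equalColumnsAtDistance d M (sym (trans (cong suc (ℕ.+-comm d (toℕ b))) eq)) (sym ∘ colsEq)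

  det-addColumnMultiple : ∀ {n} {M N : Matrix n} {c d : Fin n} (t : ℤ) → c ≢ d →
    (∀ i j → j ≢ c → N i j ≡ M i j) → (∀ i → N i c ≡ M i c + t * M i d) → det N ≡ det M
  det-addColumnMultiple {M = M} {N} {c} {d} t c≢d N≗M Nc = begin
    det N                        ≡⟨ det-linearInColumn c (+ 1) t N≗M N≗copy Nc′ ⟩
    + 1 * det M + t * det copy   ≡⟨ cong (λ x → + 1 * det M + t * x) copyZero ⟩
    + 1 * det M + t * + 0        ≡⟨ tidy (det M) t ⟩
    det M                        ∎
    where
    open ≡-Reasoning
    copy : Matrix _
    copy = withColumn M c (λ i → M i d)
    N≗copy : ∀ i j → j ≢ c → N i j ≡ copy i j
    N≗copy i j j≢c = trans (N≗M i j j≢c) (sym (withColumn-other M (λ i → M i d) i j≢c))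
    Nc′ : ∀ i → N i c ≡ + 1 * M i c + t * copy i c
    Nc′ i = trans (Nc i) (cong₂ (λ x y → x + t * y) (sym (*-identityˡ (M i c)))
                                  (sym (withColumn-same M c (λ i → M i d) i)))
    copyZero : det copy ≡ + 0
    copyZero = det-equalColumns copy c≢d λ i →
      trans (withColumn-same M c (λ i → M i d) i) (sym (withColumn-other M (λ i → M i d) i (c≢d ∘ sym)))
    tidy : ∀ x t → + 1 * x + t * + 0 ≡ x
    tidy = solve-∀

  <?-suc : ∀ {m k} → m ≢ k → does (m ℕ.<? suc k) ≡ does (m ℕ.<? k)
  <?-suc {m} {k} m≢k with m ℕ.<? k
  ... | yes m<k = trans (dec-true (m ℕ.<? suc k) (ℕ.m<n⇒m<1+n m<k)) (sym (dec-true (m ℕ.<? k) m<k))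
  ... | no m≮k  = trans (dec-false (m ℕ.<? suc k) λ m<1+k → [ m≮k , m≢k ] (ℕ.m<1+n⇒m<n∨m≡n m<1+k))
                        (sym (dec-false (m ℕ.<? k) m≮k))

  below : ∀ {n} → ℕ → (Fin n → ℤ) → Fin n → ℤ
  below k t c = if does (toℕ c ℕ.<? k) then t c else + 0

  below-zero : ∀ {n} k (t : Fin n → ℤ) {c} → t c ≡ + 0 → below k t c ≡ + 0
  below-zero k t {c} tc≡0 with does (toℕ c ℕ.<? k)
  ... | true  = tc≡0
  ... | false = refl

  addColumns : ∀ {n} → (Fin n → Fin n) → (Fin n → ℤ) → Matrix n → Matrix n
  addColumns f t M i c = M i c + t c * M i (f c)

  -- Modify the columns one at a time in increasing order; a source column is never modified
  -- because t vanishes on it.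
  det-addColumnsBelow : ∀ {n} (M : Matrix n) (f : Fin n → Fin n) (t : Fin n → ℤ) →
    (∀ c → t (f c) ≡ + 0) → ∀ k → k ℕ.≤ n → det (addColumns f (below k t) M) ≡ det M
  det-addColumnsBelow M f t sourcesFixed zero    _   = det-cong λ i c → dropZero (M i c) (M i (f c))
    where
    dropZero : ∀ x y → x + + 0 * y ≡ x
    dropZero = solve-∀
  det-addColumnsBelow M f t sourcesFixed (suc k) k<n =
    trans advance (det-addColumnsBelow M f t sourcesFixed k (ℕ.<⇒≤ k<n))
    where
    c₀ = Fin.fromℕ< k<n
    P = addColumns f (below k t) M
    new : below (suc k) t c₀ ≡ t c₀
    new rewrite toℕ-fromℕ< k<n | dec-true (k ℕ.<? suc k) (ℕ.n<1+n k) = refl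
    old : below k t c₀ ≡ + 0
    old rewrite toℕ-fromℕ< k<n | dec-false (k ℕ.<? k) (ℕ.n≮n k) = refl
    notCurrent : ∀ c → c ≢ c₀ → toℕ c ≢ k
    notCurrent c c≢c₀ eq = c≢c₀ (toℕ-injective (trans eq (sym (toℕ-fromℕ< k<n))))
    unchanged : ∀ i c → c ≢ c₀ → addColumns f (below (suc k) t) M i c ≡ P i c
    unchanged i c c≢c₀ rewrite <?-suc (notCurrent c c≢c₀) = refl
    advance : det (addColumns f (below (suc k) t) M) ≡ det P
    advance with f c₀ Fin.≟ c₀
    ... | yes fixed = det-cong λ i c → entry i c
      where
      entry : ∀ i c → addColumns f (below (suc k) t) M i c ≡ P i c
      entry i c with c Fin.≟ c₀
      ... | yes refl = cong (λ s → M i c₀ + s * M i (f c₀))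
                         (trans new (trans (subst (λ x → t x ≡ + 0) fixed (sourcesFixed c₀)) (sym old)))
      ... | no c≢c₀ = unchanged i c c≢c₀
    ... | no moved = det-addColumnMultiple (t c₀) (moved ∘ sym) unchanged λ i →
      trans (cong (λ s → M i c₀ + s * M i (f c₀)) new)
        (sym (trans (cong₂ (λ s s′ → (M i c₀ + s * M i (f c₀)) + t c₀ * (M i (f c₀) + s′ * M i (f (f c₀))))
                            old (below-zero k t (sourcesFixed c₀)))
                    (tidy (M i c₀) (M i (f c₀)) (t c₀) (M i (f (f c₀))))))
      where
      tidy : ∀ x y s z → (x + + 0 * y) + s * (y + + 0 * z) ≡ x + s * y
      tidy = solve-∀

  det-addColumns : ∀ {n} (M : Matrix n) (f : Fin n → Fin n) (t : Fin n → ℤ) →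
    (∀ c → t (f c) ≡ + 0) → det (addColumns f t M) ≡ det M
  det-addColumns {n} M f t sourcesFixed = trans
    (det-cong λ i c → cong (λ s → M i c + s * M i (f c)) (sym (belowAll c)))
    (det-addColumnsBelow M f t sourcesFixed n ℕ.≤-refl)
    where
    belowAll : ∀ c → below n t c ≡ t c
    belowAll c rewrite dec-true (toℕ c ℕ.<? n) (toℕ<n c) = refl

  det-addRows : ∀ {n} (M : Matrix n) (f : Fin n → Fin n) (t : Fin n → ℤ) →
    (∀ r → t (f r) ≡ + 0) → det (λ r j → M r j + t r * M (f r) j) ≡ det M
  det-addRows M f t sourcesFixed = begin
    det (λ r j → M r j + t r * M (f r) j)   ≡⟨ sym (det-transpose (λ r j → M r j + t r * M (f r) j)) ⟩
    det (addColumns f t (M ᵀ))              ≡⟨ det-addColumns (M ᵀ) f t sourcesFixed ⟩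
    det (M ᵀ)                               ≡⟨ det-transpose M ⟩
    det M                                   ∎
    where open ≡-Reasoning

  punchIn-↑ˡ : ∀ {k m} (j : Fin (suc k)) (b : Fin k) → punchIn (j ↑ˡ m) (b ↑ˡ m) ≡ punchIn j b ↑ˡ m
  punchIn-↑ˡ zero    b       = refl
  punchIn-↑ˡ (suc j) zero    = refl
  punchIn-↑ˡ (suc j) (suc b) = cong suc (punchIn-↑ˡ j b)

  punchIn-↑ʳ : ∀ {k m} (j : Fin (suc k)) (b : Fin m) → punchIn (j ↑ˡ m) (k ↑ʳ b) ≡ suc k ↑ʳ b
  punchIn-↑ʳ         zero    b = refl
  punchIn-↑ʳ {suc k} (suc j) b = cong suc (punchIn-↑ʳ j b)

  det-blockTriangular : ∀ k {m} (M : Matrix (k ℕ.+ m)) → (∀ i j → M (i ↑ˡ m) (k ↑ʳ j) ≡ + 0) →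
    det M ≡ det (λ i j → M (i ↑ˡ m) (j ↑ˡ m)) * det (λ i j → M (k ↑ʳ i) (k ↑ʳ j))
  det-blockTriangular zero    M _ = sym (*-identityˡ _)
  det-blockTriangular (suc k) {m} M upperZero = begin
    det M
      ≡⟨ sumℤ-↑ (suc k) (laplaceTerm M) ⟩
    sumℤ (laplaceTerm M ∘ (_↑ˡ m)) + sumℤ (laplaceTerm M ∘ (suc k ↑ʳ_))
      ≡⟨ cong₂ _+_ (sumℤ-cong leftTerm) (sumℤ-zero rightTerm) ⟩
    sumℤ (λ j → laplaceTerm P j * det Q) + + 0
      ≡⟨ +-identityʳ _ ⟩
    sumℤ (λ j → laplaceTerm P j * det Q)
      ≡⟨ sym (*-distribʳ-sumℤ (det Q) (laplaceTerm P)) ⟩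
    det P * det Q
      ∎
    where
    open ≡-Reasoning
    P : Matrix (suc k)
    P i j = M (i ↑ˡ m) (j ↑ˡ m)
    Q : Matrix m
    Q i j = M (suc k ↑ʳ i) (suc k ↑ʳ j)
    rightTerm : ∀ j → laplaceTerm M (suc k ↑ʳ j) ≡ + 0
    rightTerm j = trans (cong (λ x → sgn (toℕ (suc k ↑ʳ j)) * x * det (minor (suc k ↑ʳ j) M)) (upperZero zero j))
                        (vanish (sgn (toℕ (suc k ↑ʳ j))) (det (minor (suc k ↑ʳ j) M)))
      where
      vanish : ∀ σ d → σ * + 0 * d ≡ + 0
      vanish = solve-∀
    minorSplits : ∀ j → det (minor (j ↑ˡ m) M) ≡ det (minor j P) * det Q
    minorSplits j = trans
      (det-blockTriangular k (minor (j ↑ˡ m) M) λ a b →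
        trans (cong (M (suc a ↑ˡ m)) (punchIn-↑ʳ j b)) (upperZero (suc a) b))
      (cong₂ _*_ (det-cong λ a b → cong (M (suc a ↑ˡ m)) (punchIn-↑ˡ j b))
                 (det-cong λ a b → cong (M (suc k ↑ʳ a)) (punchIn-↑ʳ j b)))
    leftTerm : ∀ j → laplaceTerm M (j ↑ˡ m) ≡ laplaceTerm P j * det Q
    leftTerm j = trans (cong₂ (λ s d → sgn s * P zero j * d) (toℕ-↑ˡ j m) (minorSplits j))
                       (sym (*-assoc (sgn (toℕ j) * P zero j) (det (minor j P)) (det Q)))

  det-2×2 : ∀ (M : Matrix 2) → det M ≡ M zero zero * M (suc zero) (suc zero) - M zero (suc zero) * M (suc zero) zero
  det-2×2 M = expand (M zero zero) (M zero (suc zero)) (M (suc zero) zero) (M (suc zero) (suc zero))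
    where
    expand : ∀ a b c d → + 1 * a * (+ 1 * d * + 1 + + 0) + (- + 1 * b * (+ 1 * c * + 1 + + 0) + + 0) ≡ a * d - b * c
    expand = solve-∀

  det-scalarPlusConstant : ∀ α β → det {2} (λ u v → α * identity u v + β) ≡ α * (α + + 2 * β)
  det-scalarPlusConstant α β = trans (det-2×2 (λ u v → α * identity u v + β)) (formula α β)
    where
    formula : ∀ α β → (α * + 1 + β) * (α * + 1 + β) - (α * + 0 + β) * (α * + 0 + β) ≡ α * (α + + 2 * β)
    formula = solve-∀

  -- Block matrices

  identity-diag : ∀ {n} (i : Fin n) → identity i i ≡ + 1
  identity-diag i rewrite dec-true (i Fin.≟ i) refl = refl

  identity-≢ : ∀ {n} {i j : Fin n} → i ≢ j → identity i j ≡ + 0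
  identity-≢ {i = i} {j} i≢j rewrite dec-false (i Fin.≟ j) i≢j = refl

  BlockEntries : Set → ℕ → ℕ → Set
  BlockEntries A N b = Fin N → Fin b → Fin N → Fin b → A

  blockwise : ∀ {A : Set} {N b} → BlockEntries A N b → Fin (N ℕ.* b) → Fin (N ℕ.* b) → A
  blockwise {N = N} {b} K i j = K (quotient {N} b i) (remainder {N} b i) (quotient {N} b j) (remainder {N} b j)

  blockwise-at : ∀ {A : Set} {N b} (K : BlockEntries A N b) {i j I p J q} →
    remQuot {N} b i ≡ (I , p) → remQuot {N} b j ≡ (J , q) → blockwise K i j ≡ K I p J q
  blockwise-at K = cong₂ λ x y → K (proj₁ x) (proj₂ x) (proj₁ y) (proj₂ y)

  blockwise-sym : ∀ {A : Set} {N b} (K : BlockEntries A N b) → (∀ I p J q → K I p J q ≡ K J q I p) →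
    ∀ i j → blockwise K i j ≡ blockwise K j i
  blockwise-sym {N = N} {b} K K-sym i j =
    K-sym (quotient {N} b i) (remainder {N} b i) (quotient {N} b j) (remainder {N} b j)

  remQuot-↑ˡ : ∀ {N} b (p : Fin b) → remQuot {suc N} b (p ↑ˡ N ℕ.* b) ≡ (zero , p)
  remQuot-↑ˡ b p = remQuot-combine zero p

  remQuot-↑ʳ : ∀ {N} b (x : Fin (N ℕ.* b)) →
    remQuot {suc N} b (b ↑ʳ x) ≡ (suc (quotient {N} b x) , remainder {N} b x)
  remQuot-↑ʳ {N} b x rewrite splitAt-↑ʳ b (N ℕ.* b) x = refl

  identity-blockwise : ∀ {N b} (i j : Fin (N ℕ.* b)) →
    identity i j ≡ blockwise {N = N} {b} (λ I p J q → identity I J * identity p q) i j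
  identity-blockwise {N} {b} i j with i Fin.≟ j
  ... | yes refl = sym (cong₂ _*_ (identity-diag (quotient {N} b i)) (identity-diag (remainder {N} b i)))
  ... | no i≢j with quotient {N} b i Fin.≟ quotient {N} b j | remainder {N} b i Fin.≟ remainder {N} b j
  ...   | no _    | _       = refl
  ...   | yes _   | no _    = refl
  ...   | yes I≡J | yes p≡q = contradiction
    (trans (sym (combine-remQuot {N} b i)) (trans (cong₂ combine I≡J p≡q) (combine-remQuot {N} b j))) i≢j

  addBlockRow : ∀ {N b} → BlockEntries ℤ N b → Fin N → ℤ → Fin N → BlockEntries ℤ N b
  addBlockRow K I₀ t I₁ I p J q = K I p J q + identity I₀ I * t * K I₁ p J q

  addBlockColumn : ∀ {N b} → BlockEntries ℤ N b → Fin N → ℤ → Fin N → BlockEntries ℤ N b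
  addBlockColumn K J₀ t J₁ I p J q = K I p J q + identity J₀ J * t * K I p J₁ q

  det-addBlockRow : ∀ {N b} (K : BlockEntries ℤ N b) {I₀ I₁ : Fin N} (t : ℤ) → I₀ ≢ I₁ →
    det (blockwise (addBlockRow K I₀ t I₁)) ≡ det (blockwise K)
  det-addBlockRow {N} {b} K {I₀} {I₁} t I₀≢I₁ =
    trans (det-cong entry) (det-addRows (blockwise K) source coeff sourceFixed)
    where
    source : Fin (N ℕ.* b) → Fin (N ℕ.* b)
    source i = combine I₁ (remainder {N} b i)
    coeff : Fin (N ℕ.* b) → ℤ
    coeff i = identity I₀ (quotient {N} b i) * t
    sourceFixed : ∀ r → coeff (source r) ≡ + 0
    sourceFixed r = trans (cong (λ I → identity I₀ I * t) (cong proj₁ (remQuot-combine I₁ (remainder {N} b r))))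
                          (cong (_* t) (identity-≢ I₀≢I₁))
    entry : ∀ i j → blockwise (addBlockRow K I₀ t I₁) i j ≡ blockwise K i j + coeff i * blockwise K (source i) j
    entry i j = cong (λ x → blockwise K i j + coeff i * x)
      (sym (blockwise-at K (remQuot-combine I₁ (remainder {N} b i)) refl))

  det-addBlockColumn : ∀ {N b} (K : BlockEntries ℤ N b) {J₀ J₁ : Fin N} (t : ℤ) → J₀ ≢ J₁ →
    det (blockwise (addBlockColumn K J₀ t J₁)) ≡ det (blockwise K)
  det-addBlockColumn {N} {b} K {J₀} {J₁} t J₀≢J₁ =
    trans (det-cong entry) (det-addColumns (blockwise K) source coeff sourceFixed)
    where
    source : Fin (N ℕ.* b) → Fin (N ℕ.* b)
    source j = combine J₁ (remainder {N} b j)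
    coeff : Fin (N ℕ.* b) → ℤ
    coeff j = identity J₀ (quotient {N} b j) * t
    sourceFixed : ∀ c → coeff (source c) ≡ + 0
    sourceFixed c = trans (cong (λ J → identity J₀ J * t) (cong proj₁ (remQuot-combine J₁ (remainder {N} b c))))
                          (cong (_* t) (identity-≢ J₀≢J₁))
    entry : ∀ i j → blockwise (addBlockColumn K J₀ t J₁) i j ≡ addColumns source coeff (blockwise K) i j
    entry i j = cong (λ x → blockwise K i j + coeff j * x)
      (sym (blockwise-at K refl (remQuot-combine J₁ (remainder {N} b j))))

  weightedBlocks : ∀ {b} N → (Fin N → ℤ) → Matrix b → Matrix b → BlockEntries ℤ N b
  weightedBlocks N c Y W I p J q = identity I J * Y p q - c J * W p q

  mergeFirstTwo : ∀ {N} → (Fin (suc (suc N)) → ℤ) → Fin (suc N) → ℤ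
  mergeFirstTwo c J = c (suc J) + identity zero J * c zero

  sumℤ-mergeFirstTwo : ∀ {N} (c : Fin (suc (suc N)) → ℤ) → sumℤ (mergeFirstTwo c) ≡ sumℤ c
  sumℤ-mergeFirstTwo {N} c = begin
    sumℤ (mergeFirstTwo c)
      ≡⟨ sumℤ-distrib-+ (c ∘ suc) (λ J → identity zero J * c zero) ⟩
    sumℤ (c ∘ suc) + (+ 1 * c zero + sumℤ {N} (λ _ → + 0))
      ≡⟨ cong (_+_ (sumℤ (c ∘ suc))) onlyFirst ⟩
    sumℤ (c ∘ suc) + c zero
      ≡⟨ +-comm (sumℤ (c ∘ suc)) (c zero) ⟩
    sumℤ c
      ∎
    where
    open ≡-Reasoning
    onlyFirst : + 1 * c zero + sumℤ {N} (λ _ → + 0) ≡ c zero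
    onlyFirst = trans (cong₂ _+_ (*-identityˡ (c zero)) (sumℤ-zero {N} λ _ → refl)) (+-identityʳ (c zero))

  -- Subtract block row 1 from block row 0, then add block column 0 to block column 1:
  -- block row 0 becomes (Y, 0, …, 0) and the remaining blocks keep the shape of weightedBlocks.
  eliminateFirstBlock : ∀ {b} N → (Fin (suc (suc N)) → ℤ) → Matrix b → Matrix b → BlockEntries ℤ (suc (suc N)) b
  eliminateFirstBlock N c Y W =
    addBlockColumn (addBlockRow (weightedBlocks (suc (suc N)) c Y W) zero (- + 1) (suc zero)) (suc zero) (+ 1) zero

  eliminateFirstBlock-first : ∀ {b} N c (Y W : Matrix b) p J q →
    eliminateFirstBlock N c Y W zero p J q ≡ identity zero J * Y p q
  eliminateFirstBlock-first N c Y W p J q =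
    collapse (identity zero J) (identity (suc zero) J) (Y p q) (W p q) (c J) (c zero)
    where
    collapse : ∀ d₀ d₁ y w cJ c₀ →
      ((d₀ * y - cJ * w) + + 1 * - + 1 * (d₁ * y - cJ * w)) +
      d₁ * + 1 * ((+ 1 * y - c₀ * w) + + 1 * - + 1 * (+ 0 * y - c₀ * w)) ≡ d₀ * y
    collapse = solve-∀

  eliminateFirstBlock-rest : ∀ {b} N c (Y W : Matrix b) I p J q →
    eliminateFirstBlock N c Y W (suc I) p (suc J) q ≡ weightedBlocks (suc N) (mergeFirstTwo c) Y W I p J q
  eliminateFirstBlock-rest N c Y W I p J q =
    merge (identity I J) (identity zero J) (Y p q) (W p q) (c (suc J)) (c zero)
    where
    merge : ∀ d e y w cJ c₀ →
      ((d * y - cJ * w) + + 0 * - + 1 * (e * y - cJ * w)) +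
      e * + 1 * ((+ 0 * y - c₀ * w) + + 0 * - + 1 * (+ 0 * y - c₀ * w)) ≡ d * y - (cJ + e * c₀) * w
    merge = solve-∀

  det-weightedBlocks-step : ∀ {b} N (c : Fin (suc (suc N)) → ℤ) (Y W : Matrix b) →
    det (blockwise (weightedBlocks (suc (suc N)) c Y W)) ≡
    det Y * det (blockwise (weightedBlocks (suc N) (mergeFirstTwo c) Y W))
  det-weightedBlocks-step {b} N c Y W = begin
    det (blockwise K)
      ≡⟨ sym (det-addBlockRow K {zero} {suc zero} (- + 1) λ ()) ⟩
    det (blockwise (addBlockRow K zero (- + 1) (suc zero)))
      ≡⟨ sym (det-addBlockColumn (addBlockRow K zero (- + 1) (suc zero)) {suc zero} {zero} (+ 1) λ ()) ⟩
    det (blockwise E)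
      ≡⟨ det-blockTriangular b (blockwise E) upperZero ⟩
    det {b} (λ p q → blockwise E (p ↑ˡ m) (q ↑ˡ m)) * det {m} (λ x y → blockwise E (b ↑ʳ x) (b ↑ʳ y))
      ≡⟨ cong₂ _*_ (det-cong topLeft) (det-cong bottomRight) ⟩
    det Y * det (blockwise (weightedBlocks (suc N) (mergeFirstTwo c) Y W))
      ∎
    where
    open ≡-Reasoning
    m = suc N ℕ.* b
    K = weightedBlocks (suc (suc N)) c Y W
    E = eliminateFirstBlock N c Y W
    upperZero : ∀ p y → blockwise E (p ↑ˡ m) (b ↑ʳ y) ≡ + 0
    upperZero p y = trans (blockwise-at E (remQuot-↑ˡ b p) (remQuot-↑ʳ b y))
      (eliminateFirstBlock-first N c Y W p (suc (quotient {suc N} b y)) (remainder {suc N} b y))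
    topLeft : ∀ p q → blockwise E (p ↑ˡ m) (q ↑ˡ m) ≡ Y p q
    topLeft p q = trans (blockwise-at E (remQuot-↑ˡ b p) (remQuot-↑ˡ b q))
                        (trans (eliminateFirstBlock-first N c Y W p zero q) (*-identityˡ (Y p q)))
    bottomRight : ∀ x y → blockwise E (b ↑ʳ x) (b ↑ʳ y) ≡ blockwise (weightedBlocks (suc N) (mergeFirstTwo c) Y W) x y
    bottomRight x y = trans (blockwise-at E (remQuot-↑ʳ b x) (remQuot-↑ʳ b y))
      (eliminateFirstBlock-rest N c Y W (quotient {suc N} b x) (remainder {suc N} b x)
                                        (quotient {suc N} b y) (remainder {suc N} b y))

  det-weightedBlocks : ∀ {b} N (c : Fin (suc N) → ℤ) (Y W : Matrix b) →
    det (blockwise (weightedBlocks (suc N) c Y W)) ≡ det Y ^ N * det (λ p q → Y p q - sumℤ c * W p q)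
  det-weightedBlocks {b} zero c Y W = begin
    det (blockwise K)                                   ≡⟨ det-blockTriangular b (blockwise K) (λ _ ()) ⟩
    det (λ p q → blockwise K (p ↑ˡ 0) (q ↑ˡ 0)) * + 1   ≡⟨ *-identityʳ _ ⟩
    det (λ p q → blockwise K (p ↑ˡ 0) (q ↑ˡ 0))         ≡⟨ det-cong entry ⟩
    det (λ p q → Y p q - sumℤ c * W p q)                ≡⟨ sym (*-identityˡ _) ⟩
    + 1 * det (λ p q → Y p q - sumℤ c * W p q)          ∎
    where
    open ≡-Reasoning
    K = weightedBlocks 1 c Y W
    entry : ∀ p q → blockwise K (p ↑ˡ 0) (q ↑ˡ 0) ≡ Y p q - sumℤ c * W p q
    entry p q = trans (blockwise-at K (remQuot-↑ˡ b p) (remQuot-↑ˡ b q)) (single (Y p q) (W p q) (c zero))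
      where
      single : ∀ y w c₀ → + 1 * y - c₀ * w ≡ y - (c₀ + + 0) * w
      single = solve-∀
  det-weightedBlocks (suc N) c Y W = begin
    det (blockwise (weightedBlocks (suc (suc N)) c Y W))
      ≡⟨ det-weightedBlocks-step N c Y W ⟩
    det Y * det (blockwise (weightedBlocks (suc N) (mergeFirstTwo c) Y W))
      ≡⟨ cong (det Y *_) (det-weightedBlocks N (mergeFirstTwo c) Y W) ⟩
    det Y * (det Y ^ N * det (λ p q → Y p q - sumℤ (mergeFirstTwo c) * W p q))
      ≡⟨ sym (*-assoc (det Y) (det Y ^ N) _) ⟩
    det Y ^ suc N * det (λ p q → Y p q - sumℤ (mergeFirstTwo c) * W p q)
      ≡⟨ cong (λ s → det Y ^ suc N * det (λ p q → Y p q - s * W p q)) (sumℤ-mergeFirstTwo c) ⟩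
    det Y ^ suc N * det (λ p q → Y p q - sumℤ c * W p q)
      ∎
    where open ≡-Reasoning

  firstOr : ∀ {A : Set} {N} → A → A → Fin (suc N) → A
  firstOr a b zero    = a
  firstOr a b (suc _) = b

  blockSpectrum : ∀ N {b} → (Fin b → ℤ) → (Fin b → ℤ) → Fin (suc N ℕ.* b) → ℤ
  blockSpectrum N {b} e₀ e₁ i = firstOr e₀ e₁ (quotient {suc N} b i) (remainder {suc N} b i)

  prodℤ-blockSpectrum : ∀ N {b} (e₀ e₁ : Fin b → ℤ) x → prodℤ (λ i → x - blockSpectrum N e₀ e₁ i) ≡
    prodℤ (λ p → x - e₀ p) * prodℤ (λ p → x - e₁ p) ^ N
  prodℤ-blockSpectrum N {b} e₀ e₁ x = begin
    prodℤ (λ i → x - blockSpectrum N e₀ e₁ i)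
      ≡⟨ prodℤ-blocks (suc N) (λ i → x - blockSpectrum N e₀ e₁ i) ⟩
    prodℤ (λ J → prodℤ (λ q → x - blockSpectrum N e₀ e₁ (combine {suc N} {b} J q)))
      ≡⟨ prodℤ-cong (λ J → prodℤ-cong λ q → cong (λ (J , q) → x - firstOr e₀ e₁ J q) (remQuot-combine J q)) ⟩
    prodℤ (λ q → x - e₀ q) * prodℤ {N} (λ _ → prodℤ (λ q → x - e₁ q))
      ≡⟨ cong (prodℤ (λ p → x - e₀ p) *_) (prodℤ-const N (prodℤ (λ p → x - e₁ p))) ⟩
    prodℤ (λ p → x - e₀ p) * prodℤ (λ p → x - e₁ p) ^ N
      ∎
    where open ≡-Reasoning

  charPoly-weightedBlocks : ∀ {b} N (A : Matrix (suc N ℕ.* b)) (Y W : Matrix b) (e₀ e₁ : Fin b → ℤ) x →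
    (∀ i j → x * identity i j - A i j ≡ blockwise (weightedBlocks (suc N) (λ _ → + 1) Y W) i j) →
    det Y ≡ prodℤ (λ p → x - e₁ p) →
    det (λ p q → Y p q - + suc N * W p q) ≡ prodℤ (λ p → x - e₀ p) →
    charPoly A x ≡ prodℤ (λ i → x - lookup (tabulate (blockSpectrum N e₀ e₁)) i)
  charPoly-weightedBlocks N A Y W e₀ e₁ x entries detY detShifted = begin
    charPoly A x
      ≡⟨ det-cong entries ⟩
    det (blockwise (weightedBlocks (suc N) (λ _ → + 1) Y W))
      ≡⟨ det-weightedBlocks N (λ _ → + 1) Y W ⟩
    det Y ^ N * det (λ p q → Y p q - sumℤ {suc N} (λ _ → + 1) * W p q)
      ≡⟨ cong (λ s → det Y ^ N * det (λ p q → Y p q - s * W p q)) (sumℤ-ones (suc N)) ⟩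
    det Y ^ N * det (λ p q → Y p q - + suc N * W p q)
      ≡⟨ cong₂ (λ a b → a ^ N * b) detY detShifted ⟩
    prodℤ (λ p → x - e₁ p) ^ N * prodℤ (λ p → x - e₀ p)
      ≡⟨ *-comm (prodℤ (λ p → x - e₁ p) ^ N) (prodℤ (λ p → x - e₀ p)) ⟩
    prodℤ (λ p → x - e₀ p) * prodℤ (λ p → x - e₁ p) ^ N
      ≡⟨ sym (prodℤ-blockSpectrum N e₀ e₁ x) ⟩
    prodℤ (λ i → x - blockSpectrum N e₀ e₁ i)
      ≡⟨ prodℤ-cong (λ i → cong (_-_ x) (sym (lookup∘tabulate (blockSpectrum N e₀ e₁) i))) ⟩
    prodℤ (λ i → x - lookup (tabulate (blockSpectrum N e₀ e₁)) i)
      ∎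
    where open ≡-Reasoning

  -- The layered prism graph

  indicatorℤ : Bool → ℤ
  indicatorℤ b = if b then + 1 else + 0

  indicatorℤ-∧-not : ∀ a b → indicatorℤ (a ∧ not b) ≡ indicatorℤ a * (+ 1 - indicatorℤ b)
  indicatorℤ-∧-not true  true  = refl
  indicatorℤ-∧-not true  false = refl
  indicatorℤ-∧-not false _     = refl

  indicatorℤ-xor : ∀ a b → indicatorℤ (a xor b) ≡ indicatorℤ a + indicatorℤ b - + 2 * (indicatorℤ a * indicatorℤ b)
  indicatorℤ-xor true  true  = refl
  indicatorℤ-xor true  false = refl
  indicatorℤ-xor false true  = refl
  indicatorℤ-xor false false = refl

  does-≟-sym : ∀ {n} (i j : Fin n) → does (i Fin.≟ j) ≡ does (j Fin.≟ i)
  does-≟-sym i j with i Fin.≟ j | j Fin.≟ i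
  ... | yes _   | yes _   = refl
  ... | no _    | no _    = refl
  ... | yes i≡j | no j≢i  = contradiction (sym i≡j) j≢i
  ... | no i≢j  | yes j≡i = contradiction (sym j≡i) i≢j

  -- A vertex of the prism K₃ □ K₂ is a pair (corner of the triangle, side), encoded in Fin (3 * 2) = Fin 6.
  rungEntries prismEntries : BlockEntries Bool 3 2
  rungEntries  t s t′ s′ = does (t Fin.≟ t′) ∧ not (does (s Fin.≟ s′))
  prismEntries t s t′ s′ = does (t Fin.≟ t′) xor does (s Fin.≟ s′)

  rung prism : Fin 6 → Fin 6 → Bool
  rung  = blockwise rungEntries
  prism = blockwise prismEntries

  rung-sym : ∀ p q → rung p q ≡ rung q p
  rung-sym = blockwise-sym rungEntries λ t s t′ s′ →
    cong₂ (λ a b → a ∧ not b) (does-≟-sym t t′) (does-≟-sym s s′)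

  prism-sym : ∀ p q → prism p q ≡ prism q p
  prism-sym = blockwise-sym prismEntries λ t s t′ s′ → cong₂ _xor_ (does-≟-sym t t′) (does-≟-sym s s′)

  rung-irrefl : ∀ p → rung p p ≡ false
  rung-irrefl p = cong₂ (λ a b → a ∧ not b) (dec-true (t Fin.≟ t) refl) (dec-true (s Fin.≟ s) refl)
    where
    t = quotient {3} 2 p
    s = remainder {3} 2 p

  layerAdjacency : ∀ {n} → BlockEntries Bool n 6
  layerAdjacency I p J q = if does (I Fin.≟ J) then rung p q else prism p q

  layerAdjacency-sym : ∀ {n} (I : Fin n) p J q → layerAdjacency I p J q ≡ layerAdjacency J q I p
  layerAdjacency-sym I p J q =
    trans (cong (λ d → if d then rung p q else prism p q) (does-≟-sym I J))
          (cong₂ (λ r s → if does (J Fin.≟ I) then r else s) (rung-sym p q) (prism-sym p q))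

  layerAdjacency-irrefl : ∀ {n} (I : Fin n) p → layerAdjacency I p I p ≡ false
  layerAdjacency-irrefl I p =
    trans (cong (λ d → if d then rung p p else prism p p) (dec-true (I Fin.≟ I) refl)) (rung-irrefl p)

  layered : ∀ n → Graph (n ℕ.* 6)
  layered n = record
    { adj    = blockwise (layerAdjacency {n})
    ; sym    = blockwise-sym (layerAdjacency {n}) layerAdjacency-sym
    ; irrefl = λ i → layerAdjacency-irrefl (quotient {n} 6 i) (remainder {n} 6 i)
    }

  layered-adj : ∀ {n} (I : Fin n) p J q → adj (layered n) (combine I p) (combine J q) ≡ layerAdjacency I p J q
  layered-adj I p J q = blockwise-at layerAdjacency (remQuot-combine I p) (remQuot-combine J q)

  indicatorℕ : Bool → ℕ
  indicatorℕ b = if b then 1 else 0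

  rung-degree : ∀ p → sumℕ (λ q → indicatorℕ (rung p q)) ≡ 1
  rung-degree = from-yes (all? λ p → sumℕ (λ q → indicatorℕ (rung p q)) ℕ.≟ 1)

  prism-degree : ∀ p → sumℕ (λ q → indicatorℕ (prism p q)) ≡ 3
  prism-degree = from-yes (all? λ p → sumℕ (λ q → indicatorℕ (prism p q)) ℕ.≟ 3)

  layerAdjacency-degree : ∀ d p →
    sumℕ (λ q → indicatorℕ (if d then rung p q else prism p q)) ≡ (if d then 1 else 3)
  layerAdjacency-degree true  = rung-degree
  layerAdjacency-degree false = prism-degree

  layered-regular : ∀ N → Regular (layered (suc N)) (3 ℕ.* suc N ℕ.∸ 2)
  layered-regular N v = begin
    sumℕ (λ w → indicatorℕ (blockwise K v w))
      ≡⟨ sumℕ-blocks (suc N) (λ w → indicatorℕ (blockwise K v w)) ⟩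
    sumℕ (λ J → sumℕ (λ q → indicatorℕ (blockwise K v (combine {suc N} {6} J q))))
      ≡⟨ sumℕ-cong (λ J → sumℕ-cong λ q →
           cong indicatorℕ (blockwise-at K {v} {combine J q} refl (remQuot-combine J q))) ⟩
    sumℕ (λ J → sumℕ (λ q → indicatorℕ (K I p J q)))
      ≡⟨ sumℕ-cong (λ J → layerAdjacency-degree (does (I Fin.≟ J)) p) ⟩
    sumℕ (λ J → if does (I Fin.≟ J) then 1 else 3)
      ≡⟨ sumℕ-≟ I 1 3 ⟩
    suc (N ℕ.* 3)
      ≡⟨ cong suc (ℕ.*-comm N 3) ⟩
    suc (3 ℕ.* N)
      ≡⟨ sym (cong (ℕ._∸ 2) (ℕ.*-suc 3 N)) ⟩
    3 ℕ.* suc N ℕ.∸ 2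
      ∎
    where
    open ≡-Reasoning
    K = layerAdjacency {suc N}
    I = quotient {suc N} 6 v
    p = remainder {suc N} 6 v

  module _ {m} {G : Graph m} where

    walk-++ : ∀ {u v w} → Walk G u v → Walk G v w → Walk G u w
    walk-++ here           vw = vw
    walk-++ (step uu′ u′v) vw = step uu′ (walk-++ u′v vw)

    walk-reverse : ∀ {u v} → Walk G u v → Walk G v u
    walk-reverse here                    = here
    walk-reverse (step {u} {u′} uu′ u′v) = walk-++ (walk-reverse u′v) (step (trans (Graph.sym G u′ u) uu′) here)

    connected-viaHub : (h : Fin m) → (∀ u → Walk G u h) → Connected G
    connected-viaHub h toHub u v = walk-++ (toHub u) (walk-reverse (toHub v))

  -- Every vertex of another layer has a prism neighbour in layer 0, and every vertex of layer 0
  -- reaches the hub (0, 0) by a rung or through layer 1.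
  layered-connected : ∀ N → Connected (layered (suc (suc N)))
  layered-connected N = connected-viaHub hub λ u →
    subst (λ u → Walk G u hub) (combine-remQuot {n} 6 u) (toHub (quotient {n} 6 u) (remainder {n} 6 u))
    where
    n = suc (suc N)
    G = layered n
    vertex : Fin n → Fin 6 → Fin (n ℕ.* 6)
    vertex = combine
    hub = vertex zero zero
    viaSecondLayer : ∀ p q → prism p q ≡ true → prism q zero ≡ true → Walk G (vertex zero p) hub
    viaSecondLayer p q pq q0 = step {w = vertex (suc zero) q} (trans (layered-adj zero p (suc zero) q) pq)
                                    (step (trans (layered-adj (suc zero) q zero zero) q0) here)
    inFirstLayer : ∀ p → Walk G (vertex zero p) hub
    inFirstLayer zero = here
    inFirstLayer (suc zero) = step (layered-adj {n} zero (suc zero) zero zero) here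
    inFirstLayer p@(suc (suc zero))                   = viaSecondLayer p (suc (suc (suc (suc zero)))) refl refl
    inFirstLayer p@(suc (suc (suc zero)))             = viaSecondLayer p (suc zero) refl refl
    inFirstLayer p@(suc (suc (suc (suc zero))))       = viaSecondLayer p (suc (suc zero)) refl refl
    inFirstLayer p@(suc (suc (suc (suc (suc zero))))) = viaSecondLayer p (suc zero) refl refl
    partner : Fin 6 → Fin 6
    partner p = combine (quotient {3} 2 p) (Fin.opposite (remainder {3} 2 p))
    toHub : ∀ I p → Walk G (vertex I p) hub
    toHub zero    p = inFirstLayer p
    toHub (suc I) p = step (trans (layered-adj (suc I) p zero (partner p))
                                  (from-yes (all? λ p → prism p (partner p) Data.Bool.≟ true) p))
                           (inFirstLayer (partner p))

  prismMatrix : Matrix 6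
  prismMatrix p q = indicatorℤ (prism p q)

  -- Y = xI + C, where C = prism − rungs is the adjacency matrix of the two triangles.
  layerBlock : ℤ → Matrix 6
  layerBlock x p q = x * identity p q - indicatorℤ (rung p q) + prismMatrix p q

  layered-charMatrix : ∀ N x (i j : Fin (N ℕ.* 6)) →
    x * identity i j - adjMatrix (layered N) i j ≡ blockwise (weightedBlocks N (λ _ → + 1) (layerBlock x) prismMatrix) i j
  layered-charMatrix N x i j =
    trans (cong (λ e → x * e - adjMatrix (layered N) i j) (identity-blockwise {N} {6} i j))
          (layerEntry (does (I Fin.≟ J)) (identity p q) (rung p q) (prism p q))
    where
    I = quotient {N} 6 i
    J = quotient {N} 6 j
    p = remainder {N} 6 i
    q = remainder {N} 6 j
    layerEntry : ∀ d e r c → x * (indicatorℤ d * e) - indicatorℤ (if d then r else c) ≡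
                             indicatorℤ d * (x * e - indicatorℤ r + indicatorℤ c) - + 1 * indicatorℤ c
    layerEntry true  e r c = sameLayer x e (indicatorℤ r) (indicatorℤ c)
      where
      sameLayer : ∀ x e a b → x * (+ 1 * e) - a ≡ + 1 * (x * e - a + b) - + 1 * b
      sameLayer = solve-∀
    layerEntry false e r c = otherLayer x e (indicatorℤ r) (indicatorℤ c)
      where
      otherLayer : ∀ x e a b → x * (+ 0 * e) - b ≡ + 0 * (x * e - a + b) - + 1 * b
      otherLayer = solve-∀

  triangleDiagonal : ℤ → ℤ → Matrix 2
  triangleDiagonal x s u v = (x + + 2 * s - + 1) * identity u v + - s

  triangleOffDiagonal : ℤ → Matrix 2
  triangleOffDiagonal s u v = (s - + 1) * identity u v

  layerPencil-blocks : ∀ x s p q → layerBlock x p q - s * prismMatrix p q ≡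
    blockwise (weightedBlocks 3 (λ _ → + 1) (triangleDiagonal x s) (triangleOffDiagonal s)) p q
  layerPencil-blocks x s p q =
    trans (cong₂ (λ e r → shape e r (indicatorℤ (prism p q))) (identity-blockwise {3} {2} p q) (indicatorℤ-∧-not d₁ d₂))
      (trans (cong (shape (indicatorℤ d₁ * indicatorℤ d₂) (indicatorℤ d₁ * (+ 1 - indicatorℤ d₂))) (indicatorℤ-xor d₁ d₂))
             (coordinates x s (indicatorℤ d₁) (indicatorℤ d₂)))
    where
    d₁ = does (quotient {3} 2 p Fin.≟ quotient {3} 2 q)
    d₂ = does (remainder {3} 2 p Fin.≟ remainder {3} 2 q)
    shape : ℤ → ℤ → ℤ → ℤ
    shape e r c = x * e - r + c - s * c
    coordinates : ∀ x s e₁ e₂ →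
      x * (e₁ * e₂) - e₁ * (+ 1 - e₂) + (e₁ + e₂ - + 2 * (e₁ * e₂)) - s * (e₁ + e₂ - + 2 * (e₁ * e₂)) ≡
      e₁ * ((x + + 2 * s - + 1) * e₂ + - s) - + 1 * ((s - + 1) * e₂)
    coordinates = solve-∀

  spectrum : ℤ → Fin 6 → ℤ
  spectrum s = lookup (+ 1 - + 2 * s ∷ + 1 - + 2 * s ∷ + 1 ∷ + 1 ∷ s - + 2 ∷ + 3 * s - + 2 ∷ [])

  -- The matrices are given to det-cong explicitly: inferring them makes Agda unfold the 6 × 6 determinant.
  det-layerPencil : ∀ x s → det (λ p q → layerBlock x p q - s * prismMatrix p q) ≡ prodℤ (λ p → x - spectrum s p)
  det-layerPencil x s = begin
    det (λ p q → layerBlock x p q - s * prismMatrix p q)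
      ≡⟨ det-cong {M = λ p q → layerBlock x p q - s * prismMatrix p q} {blockwise (weightedBlocks 3 (λ _ → + 1) A B)}
                  (layerPencil-blocks x s) ⟩
    det (blockwise (weightedBlocks 3 (λ _ → + 1) A B))
      ≡⟨ det-weightedBlocks 2 (λ _ → + 1) A B ⟩
    det A ^ 2 * det {2} (λ u v → A u v - sumℤ {3} (λ _ → + 1) * B u v)
      ≡⟨ cong (det A ^ 2 *_) (det-cong reduced) ⟩
    det A ^ 2 * det {2} (λ u v → (x - s + + 2) * identity u v + - s)
      ≡⟨ cong₂ (λ a b → a ^ 2 * b) (det-scalarPlusConstant α (- s)) (det-scalarPlusConstant (x - s + + 2) (- s)) ⟩
    (α * (α + + 2 * - s)) ^ 2 * ((x - s + + 2) * ((x - s + + 2) + + 2 * - s))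
      ≡⟨ factorise x s ⟩
    prodℤ (λ p → x - spectrum s p)
      ∎
    where
    open ≡-Reasoning
    α = x + + 2 * s - + 1
    A = triangleDiagonal x s
    B = triangleOffDiagonal s
    reduced : ∀ u v → A u v - sumℤ {3} (λ _ → + 1) * B u v ≡ (x - s + + 2) * identity u v + - s
    reduced u v = shrink x s (identity u v)
      where
      shrink : ∀ x s d → ((x + + 2 * s - + 1) * d + - s) - (+ 1 + (+ 1 + (+ 1 + + 0))) * ((s - + 1) * d) ≡
                         (x - s + + 2) * d + - s
      shrink = solve-∀
    factorise : ∀ x s →
      ((x + + 2 * s - + 1) * ((x + + 2 * s - + 1) + + 2 * - s)) *
        (((x + + 2 * s - + 1) * ((x + + 2 * s - + 1) + + 2 * - s)) * + 1) *
        ((x - s + + 2) * ((x - s + + 2) + + 2 * - s)) ≡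
      (x - (+ 1 - + 2 * s)) * ((x - (+ 1 - + 2 * s)) * ((x - + 1) * ((x - + 1) *
        ((x - (s - + 2)) * ((x - (+ 3 * s - + 2)) * + 1)))))
    factorise = solve-∀

  det-layerBlock : ∀ x → det (layerBlock x) ≡ prodℤ (λ p → x - spectrum (+ 0) p)
  det-layerBlock x = trans (det-cong {M = layerBlock x} {λ p q → layerBlock x p q - + 0 * prismMatrix p q}
                                     λ p q → sym (+-identityʳ (layerBlock x p q)))
                           (det-layerPencil x (+ 0))

  layered-integral : ∀ N → Integral (layered (suc N))
  layered-integral N = tabulate (blockSpectrum N (spectrum (+ suc N)) (spectrum (+ 0))) , λ x →
    charPoly-weightedBlocks N (adjMatrix (layered (suc N))) (layerBlock x) prismMatrix
      (spectrum (+ suc N)) (spectrum (+ 0)) x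
      (layered-charMatrix (suc N) x) (det-layerBlock x) (det-layerPencil x (+ suc N))

open import Defs
open import Data.Nat using (ℕ; suc; _*_; _∸_; _<_; s≤s; z≤n)
open import Data.Nat.Properties using (*-comm)
open import Data.Product using (Σ; _×_; _,_)
open import Relation.Binary.PropositionalEquality using (subst)
open LayeredPrism using (layered; layered-connected; layered-regular; layered-integral)

corollary6 : (n : ℕ) → 1 < n →
    Σ (Graph (6 * n)) (λ G → Connected G × Regular G (3 * n ∸ 2) × Integral G)
corollary6 (suc (suc N)) (s≤s (s≤s z≤n)) =
  subst (λ m → Σ (Graph m) λ G → Connected G × Regular G (3 * suc (suc N) ∸ 2) × Integral G)
        (*-comm (suc (suc N)) 6)
        (layered (suc (suc N)) , layered-connected N , layered-regular (suc N) , layered-integral (suc N))
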